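{- Every element-removal game is integer-valued; that is, its value (with White as the Left player and Black as the Right player) is equal to an integer in Conway's sense. In particular, every pomax game is integer-valued.
   Context: An element-removal game is specified by a finite set $X$ whose elements are each colored black or white, together with a removability function $\rho\colon 2^X\to 2^X$ satisfying $\rho(B)\cap A\subseteq \rho(A)\subseteq A$ for all $A\subseteq B\subseteq X$. A position is a subset $A\subseteq X$ of elements still present (the starting position is $X$). The two players, White and Black, alternate; on his turn a player removes one element of $\rho(A)$ of his own color, passing to the position $A$ minus that element. A player who cannot move loses. This is regarded as a partizan combinatorial game in Conway's sense, with White the Left (positive) player and Black the Right (negative) player; a game is integer-valued if it is equal (in the standard equivalence of games) to $1+1+\dots+1$ or its negative or to $0$, where $1=\{0\,|\,\}$. A pomax game is the special case where $X$ is a finite poset and $\rho(A)$ is the set of maximal elements of the subposet induced on $A$: players alternately remove a maximal element of their own color from the remaining poset. -}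

module Defs where

open import Data.Nat as ℕ using (ℕ; zero; suc)
open import Data.Integer using (ℤ; +_; -[1+_])
open import Data.Fin using (Fin; splitAt)
open import Data.Fin.Subset using (Subset; _∈_; _∉_; _⊆_; _∩_; _-_)
open import Data.Fin.Subset.Properties using (_∈?_)
open import Data.Fin.Properties using (any?; _≟_)
open import Data.List using (List; filter; length; lookup; allFin)
open import Data.Vec using (tabulate)
open import Data.Bool using (Bool; not; _∧_)
open import Data.Sum using ([_,_]′)
open import Data.Product using (Σ; ∃; _×_; _,_)
open import Data.Empty using (⊥)
open import Relation.Nullary using (¬_; Dec; does; ¬?; yes; no)
open import Relation.Nullary.Decidable using (_×-dec_)
open import Relation.Binary.PropositionalEquality using (_≡_; _≢_; refl)
open import Relation.Binary.Structures using (IsDecPartialOrder)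

data Game : Set where
  mk : (nL : ℕ) → (Fin nL → Game) → (nR : ℕ) → (Fin nR → Game) → Game

infix 4 _≤G_ _≈G_
_≤G_ : Game → Game → Set
mk nL gL nR gR ≤G mk mL hL mR hR =
  ((i : Fin nL) → ¬ (mk mL hL mR hR ≤G gL i)) ×
  ((j : Fin mR) → ¬ (hR j ≤G mk nL gL nR gR))

_≈G_ : Game → Game → Set
G ≈G H = (G ≤G H) × (H ≤G G)

infixl 6 _+G_
_+G_ : Game → Game → Game
mk nL gL nR gR +G mk mL hL mR hR =
  mk (nL ℕ.+ mL)
     (λ k → [ (λ i → gL i +G mk mL hL mR hR) , (λ j → mk nL gL nR gR +G hL j) ]′ (splitAt nL k))
     (nR ℕ.+ mR)
     (λ k → [ (λ i → gR i +G mk mL hL mR hR) , (λ j → mk nL gL nR gR +G hR j) ]′ (splitAt nR k))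

-G_ : Game → Game
-G mk nL gL nR gR = mk nR (λ j → -G (gR j)) nL (λ i → -G (gL i))

0G : Game
0G = mk 0 (λ ()) 0 (λ ())

1G : Game
1G = mk 1 (λ _ → 0G) 0 (λ ())

ones : ℕ → Game
ones zero = 0G
ones (suc m) = ones m +G 1G

intGame : ℤ → Game
intGame (+ m) = ones m
intGame -[1+ m ] = -G (ones (suc m))

IntegerValued : Game → Set
IntegerValued G = ∃ λ (z : ℤ) → G ≈G intGame z

data Color : Set where
  white black : Color

_≟C_ : (a b : Color) → Dec (a ≡ b)
white ≟C white = yes refl
white ≟C black = no (λ ())
black ≟C white = no (λ ())
black ≟C black = yes refl

IsRemovability : (n : ℕ) → (Subset n → Subset n) → Set
IsRemovability n ρ =
  ((A B : Subset n) → A ⊆ B → (ρ B ∩ A) ⊆ ρ A) × ((A : Subset n) → ρ A ⊆ A)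

movesOf : {n : ℕ} → (Fin n → Color) → (Subset n → Subset n) → Subset n → Color → List (Fin n)
movesOf col ρ A c = filter (λ x → (x ∈? ρ A) ×-dec (col x ≟C c)) (allFin _)

-- The natural-number argument is fuel: each move
-- removes one element of A (since ρ A ⊆ A), so starting with fuel n at
-- position X the fuel never runs out before the position has no moves
-- (with fuel 0 the position is ∅, where ρ ∅ = ∅ and the game is 0).
positionGame : {n : ℕ} → (Fin n → Color) → (Subset n → Subset n) → ℕ → Subset n → Game
positionGame col ρ zero A = 0G
positionGame col ρ (suc k) A =
  mk (length (movesOf col ρ A white))
     (λ i → positionGame col ρ k (A - lookup (movesOf col ρ A white) i))
     (length (movesOf col ρ A black))
     (λ j → positionGame col ρ k (A - lookup (movesOf col ρ A black) j))

elementRemovalGame : (n : ℕ) → (Fin n → Color) → (Subset n → Subset n) → Game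
elementRemovalGame n col ρ = positionGame col ρ n Data.Fin.Subset.⊤

maximalIn : {n : ℕ} (_≤P_ : Fin n → Fin n → Set) →
            (∀ x y → Dec (x ≤P y)) → Subset n → Subset n
maximalIn _≤P_ _≤?_ A =
  tabulate (λ x → does (x ∈? A) ∧
    not (does (any? (λ y → (y ∈? A) ×-dec ((x ≤? y) ×-dec ¬? (x ≟ y))))))

pomaxGame : (n : ℕ) (_≤P_ : Fin n → Fin n → Set) → IsDecPartialOrder _≡_ _≤P_ →
            (Fin n → Color) → Game
pomaxGame n _≤P_ po col =
  elementRemovalGame n col (maximalIn _≤P_ (IsDecPartialOrder._≤?_ po))

-- Write G ⇓ z (G is hereditarily integer-valued with value z) when every option
-- of G is, and z is the simplest integer strictly between the Left and the Right
-- option values; then G equals the canonical integer z.  Such games are closed under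
-- negation and sums, so 1 + ⋯ + 1 is one of them.
-- In an element-removal game let White remove x and Black remove y from a
-- position A.  By the removability axiom y is still removable from A - x and x
-- from A - y, and both lead to A - x - y, whose value c is a Right option value
-- of A - x and a Left option value of A - y.  Hence val(A - x) < c < val(A - y):
-- Left and Right option values are at least 2 apart, so a simplest integer
-- between them exists, and induction on the position finishes the proof.
-- Maximal elements of a poset form a removability function.
module Submission where

open import Defs
open import Data.Nat as ℕ using (ℕ; zero; suc; z≤n; s≤s)
import Data.Nat.Properties as ℕ
open import Data.Integer
  using (ℤ; +_; -[1+_]; 0ℤ; 1ℤ; -1ℤ; _+_; -_; pred; _≤_; _<_; _≤?_; _<?_; -<-; -<+; +<+)
  renaming (suc to sucℤ)
open import Data.Integer.Properties
  using (≤-refl; ≤-trans; ≤-<-trans; <-≤-trans; <-irrefl; <-asym; <-cmp; <⇒≱; ≮⇒≥; ≰⇒>;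
         ≤-totalOrder; +-comm; +-assoc; +-mono-≤; +-monoˡ-<; +-monoʳ-<; neg-involutive; neg-distrib-+;
         neg-mono-<; suc-pred; pred-suc; +-pred; pred-+; suc[i]≤j⇒i<j; i<j⇒suc[i]≤j; i≤pred[j]⇒i<j;
         i<j⇒i≤pred[j])
open import Data.Fin using (Fin; zero; suc; splitAt; _↑ˡ_; _↑ʳ_)
open import Data.Fin.Properties using (any?; _≟_; splitAt-↑ˡ; splitAt-↑ʳ)
open import Data.Fin.Subset using (Subset; _∈_; _-_; _∩_; _⊆_; ∣_∣; ⊤)
open import Data.Fin.Subset.Properties
  using (_∈?_; x∈p∧x≢y⇒x∈p-y; p─x─y≡p─y─x; x∈p⇒∣p-x∣<∣p∣; p─q⊆p; x∈p∩q⁺; x∈p∩q⁻; ∣p∣≤n)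
open import Data.List using (length; lookup; allFin)
open import Data.List.Extrema ≤-totalOrder
  using (argmax; argmin; f[xs]≤f[argmax]; f[argmin]≤f[xs])
open import Data.List.Membership.Propositional.Properties
  using (∈-filter⁺; ∈-filter⁻; ∈-lookup; ∈-allFin)
open import Data.List.Relation.Unary.All as All using ()
open import Data.List.Relation.Unary.Any using (index)
open import Data.List.Relation.Unary.Any.Properties using (lookup-index)
open import Data.Vec using (tabulate)
open import Data.Vec.Properties using ([]=⇒lookup; lookup⇒[]=; lookup∘tabulate)
open import Data.Bool using (Bool; true; not; _∧_)
open import Data.Sum using (_⊎_; inj₁; inj₂; [_,_]; [_,_]′)
open import Data.Product using (∃; ∃-syntax; _×_; _,_; proj₁; proj₂)
open import Data.Empty using (⊥-elim)
open import Function using (_∘_; _⇔_; mk⇔; Equivalence)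
open import Relation.Binary using (tri<; tri≈; tri>)
open import Relation.Binary.Structures using (IsDecPartialOrder)
open import Relation.Binary.PropositionalEquality
  using (_≡_; _≢_; refl; sym; trans; cong; subst; module ≡-Reasoning)
open import Relation.Nullary using (¬_; Dec; yes; no; does; ¬?)
open import Relation.Nullary.Decidable using (_×-dec_)

#left : Game → ℕ
#left (mk nL _ _ _) = nL

left : (G : Game) → Fin (#left G) → Game
left (mk _ gL _ _) = gL

#right : Game → ℕ
#right (mk _ _ nR _) = nR

right : (G : Game) → Fin (#right G) → Game
right (mk _ _ _ gR) = gR

≤G-left : ∀ G H → G ≤G H → ∀ i → ¬ (H ≤G left G i)
≤G-left (mk _ _ _ _) (mk _ _ _ _) = proj₁

≤G-right : ∀ G H → G ≤G H → ∀ j → ¬ (right H j ≤G G)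
≤G-right (mk _ _ _ _) (mk _ _ _ _) = proj₂

≤G-intro : ∀ G H → (∀ i → ¬ (H ≤G left G i)) → (∀ j → ¬ (right H j ≤G G)) → G ≤G H
≤G-intro (mk _ _ _ _) (mk _ _ _ _) = _,_

≤G-refl : ∀ G → G ≤G G
≤G-refl G@(mk _ gL _ gR) =
  (λ i gL≥G → ≤G-left G (gL i) gL≥G i (≤G-refl (gL i))) ,
  (λ j gR≤G → ≤G-right (gR j) G gR≤G j (≤G-refl (gR j)))

≤G-trans : ∀ G H K → G ≤G H → H ≤G K → G ≤G K
≤G-trans G@(mk _ gL _ _) H@(mk _ _ _ _) K@(mk _ _ _ kR) G≤H H≤K =
  (λ i K≤gL → ≤G-left G H G≤H i (≤G-trans H K (gL i) H≤K K≤gL)) ,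
  (λ j kR≤G → ≤G-right H K H≤K j (≤G-trans (kR j) G H kR≤G G≤H))

≰-left : ∀ G i → ¬ (G ≤G left G i)
≰-left G i G≤gL = ≤G-left G (left G i) G≤gL i (≤G-refl (left G i))

right-≰ : ∀ G j → ¬ (right G j ≤G G)
right-≰ G j gR≤G = ≤G-right (right G j) G gR≤G j (≤G-refl (right G j))

pos : ℕ → Game
pos zero    = 0G
pos (suc n) = mk 1 (λ _ → pos n) 0 (λ ())

neg : ℕ → Game
neg zero    = 0G
neg (suc n) = mk 0 (λ ()) 1 (λ _ → neg n)

canon : ℤ → Game
canon (+ n)    = pos n
canon -[1+ n ] = neg (suc n)

pos-mono : ∀ {m n} → m ℕ.≤ n → pos m ≤G pos n
pos-strict : ∀ {m n} → m ℕ.< n → ¬ (pos n ≤G pos m)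

pos-mono {n = zero}  z≤n = (λ ()) , (λ ())
pos-mono {n = suc n} z≤n = (λ ()) , (λ ())
pos-mono (s≤s m≤n) = (λ _ → pos-strict (s≤s m≤n)) , (λ ())

pos-strict {m} {suc n} (s≤s m≤n) pos≤ = ≤G-left (pos (suc n)) (pos m) pos≤ zero (pos-mono m≤n)

neg-mono : ∀ {m n} → m ℕ.≤ n → neg n ≤G neg m
neg-strict : ∀ {m n} → m ℕ.< n → ¬ (neg m ≤G neg n)

neg-mono {n = zero}  z≤n = (λ ()) , (λ ())
neg-mono {n = suc n} z≤n = (λ ()) , (λ ())
neg-mono (s≤s m≤n) = (λ ()) , (λ _ → neg-strict (s≤s m≤n))

neg-strict {m} {suc n} (s≤s m≤n) ≤neg = ≤G-right (neg m) (neg (suc n)) ≤neg zero (neg-mono m≤n)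

neg≤pos : ∀ m n → neg m ≤G pos n
neg≤pos zero    zero    = (λ ()) , (λ ())
neg≤pos zero    (suc n) = (λ ()) , (λ ())
neg≤pos (suc m) zero    = (λ ()) , (λ ())
neg≤pos (suc m) (suc n) = (λ ()) , (λ ())

canon-strict : ∀ {a b} → a < b → ¬ (canon b ≤G canon a)
canon-strict (+<+ m<n)         = pos-strict m<n
canon-strict (-<- n<m)         = neg-strict (s≤s n<m)
canon-strict (-<+ {m} {n}) ≤neg = ≤G-right (pos n) (neg (suc m)) ≤neg zero (neg≤pos m n)

canon-left : ∀ z i → 0ℤ < z × left (canon z) i ≡ canon (pred z)
canon-left (+ suc n) zero = +<+ (s≤s z≤n) , refl
canon-left (+ zero)  ()
canon-left -[1+ n ]  ()

canon-right : ∀ z j → z < 0ℤ × right (canon z) j ≡ canon (sucℤ z)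
canon-right -[1+ zero ]  zero = -<+ , refl
canon-right -[1+ suc n ] zero = -<+ , refl
canon-right (+ zero)     ()
canon-right (+ suc n)    ()

-- z has least absolute value strictly between vL and vR: for z > 0 the integer
-- z - 1 is already a Left value, and dually for z < 0.
record SimplestBetween {nL nR} (vL : Fin nL → ℤ) (vR : Fin nR → ℤ) (z : ℤ) : Set where
  field
    left<     : ∀ i → vL i < z
    <right    : ∀ j → z < vR j
    pred∈left : 0ℤ < z → ∃[ i ] vL i ≡ pred z
    suc∈right : z < 0ℤ → ∃[ j ] vR j ≡ sucℤ z

open SimplestBetween

infix 4 _⇓_
data _⇓_ : Game → ℤ → Set where
  byOptions : ∀ {nL gL nR gR z} {vL : Fin nL → ℤ} {vR : Fin nR → ℤ} →
              (∀ i → gL i ⇓ vL i) → (∀ j → gR j ⇓ vR j) → SimplestBetween vL vR z →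
              mk nL gL nR gR ⇓ z

⇓-sound : ∀ {G z} → G ⇓ z → G ≈G canon z
⇓-sound {G} {z} (byOptions {gL = gL} {gR = gR} {vL = vL} {vR} gL⇓ gR⇓ s) = G≤z , z≤G
  where
  gL≈ : ∀ i → gL i ≈G canon (vL i)
  gL≈ i = ⇓-sound (gL⇓ i)
  gR≈ : ∀ j → gR j ≈G canon (vR j)
  gR≈ j = ⇓-sound (gR⇓ j)

  G≤z : G ≤G canon z
  G≤z = ≤G-intro G (canon z)
    (λ i z≤gL → canon-strict (left< s i) (≤G-trans (canon z) (gL i) (canon (vL i)) z≤gL (proj₁ (gL≈ i))))
    (λ j′ zR≤G → let (z<0 , zR≡) = canon-right z j′ ; (j , vRj≡) = suc∈right s z<0 in
      right-≰ G j (≤G-trans (gR j) (canon (vR j)) G (proj₁ (gR≈ j))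
        (subst (_≤G G) (trans zR≡ (cong canon (sym vRj≡))) zR≤G)))

  z≤G : canon z ≤G G
  z≤G = ≤G-intro (canon z) G
    (λ i′ G≤zL → let (0<z , zL≡) = canon-left z i′ ; (i , vLi≡) = pred∈left s 0<z in
      ≰-left G i (≤G-trans G (canon (vL i)) (gL i)
        (subst (G ≤G_) (trans zL≡ (cong canon (sym vLi≡))) G≤zL) (proj₂ (gL≈ i))))
    (λ j gR≤z → canon-strict (<right s j) (≤G-trans (canon (vR j)) (gR j) (canon z) (proj₂ (gR≈ j)) gR≤z))

⇓-unique : ∀ {G a b} → G ⇓ a → G ⇓ b → a ≡ b
⇓-unique {G} {a} {b} G⇓a G⇓b with <-cmp a b
... | tri< a<b _ _ = ⊥-elim (canon-strict a<b
                       (≤G-trans (canon b) G (canon a) (proj₂ (⇓-sound G⇓b)) (proj₁ (⇓-sound G⇓a))))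
... | tri≈ _ a≡b _ = a≡b
... | tri> _ _ b<a = ⊥-elim (canon-strict b<a
                       (≤G-trans (canon a) G (canon b) (proj₂ (⇓-sound G⇓a)) (proj₁ (⇓-sound G⇓b))))

simplest : ∀ {nL nR} (vL : Fin nL → ℤ) (vR : Fin nR → ℤ) →
           (∀ i j → sucℤ (vL i) < vR j) → ∃ (SimplestBetween vL vR)
simplest {nL} {nR} vL vR gap with any? (λ i → 0ℤ ≤? vL i) | any? (λ j → vR j ≤? 0ℤ)
... | yes (i₀ , 0≤vLi₀) | _ = sucℤ (vL top) , record
  { left<     = λ i → ≤-<-trans (top-max i) top<suc
  ; <right    = gap top
  ; pred∈left = λ _ → top , sym (pred-suc (vL top))
  ; suc∈right = λ z<0 → ⊥-elim (<-asym z<0 (≤-<-trans 0≤vLi₀ (≤-<-trans (top-max i₀) top<suc)))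
  }
  where
  top = argmax vL i₀ (allFin nL)
  top-max : ∀ i → vL i ≤ vL top
  top-max i = All.lookup (f[xs]≤f[argmax] i₀ (allFin nL)) (∈-allFin i)
  top<suc : vL top < sucℤ (vL top)
  top<suc = suc[i]≤j⇒i<j ≤-refl
... | no vL<0 | yes (j₀ , vRj₀≤0) = pred (vR bot) , record
  { left<     = λ i → suc[i]≤j⇒i<j (i<j⇒i≤pred[j] (gap i bot))
  ; <right    = λ j → <-≤-trans pred<bot (bot-min j)
  ; pred∈left = λ 0<z → ⊥-elim (<-asym 0<z (<-≤-trans pred<bot (≤-trans (bot-min j₀) vRj₀≤0)))
  ; suc∈right = λ _ → bot , sym (suc-pred (vR bot))
  }
  where
  bot = argmin vR j₀ (allFin nR)
  bot-min : ∀ j → vR bot ≤ vR j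
  bot-min j = All.lookup (f[argmin]≤f[xs] j₀ (allFin nR)) (∈-allFin j)
  pred<bot : pred (vR bot) < vR bot
  pred<bot = i≤pred[j]⇒i<j ≤-refl
... | no vL<0 | no 0<vR = 0ℤ , record
  { left<     = λ i → ≰⇒> (λ 0≤vLi → vL<0 (i , 0≤vLi))
  ; <right    = λ j → ≰⇒> (λ vRj≤0 → 0<vR (j , vRj≤0))
  ; pred∈left = λ 0<0 → ⊥-elim (<-irrefl refl 0<0)
  ; suc∈right = λ 0<0 → ⊥-elim (<-irrefl refl 0<0)
  }

⇓-neg : ∀ {G a} → G ⇓ a → -G G ⇓ - a
⇓-neg {a = a} (byOptions gL⇓ gR⇓ s) = byOptions (⇓-neg ∘ gR⇓) (⇓-neg ∘ gL⇓) record
  { left<     = λ j → neg-mono-< (<right s j)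
  ; <right    = λ i → neg-mono-< (left< s i)
  ; pred∈left = λ 0<-a → let (j , vRj≡) = suc∈right s (<0 0<-a) in
                  j , trans (cong -_ vRj≡) (neg-distrib-+ 1ℤ a)
  ; suc∈right = λ -a<0 → let (i , vLi≡) = pred∈left s (0< -a<0) in
                  i , trans (cong -_ vLi≡) (neg-distrib-+ -1ℤ a)
  }
  where
  <0 : 0ℤ < - a → a < 0ℤ
  <0 0<-a = subst (_< 0ℤ) (neg-involutive a) (neg-mono-< 0<-a)
  0< : - a < 0ℤ → 0ℤ < a
  0< -a<0 = subst (0ℤ <_) (neg-involutive a) (neg-mono-< -a<0)

0<+⇒0<⊎0< : ∀ {a b} → 0ℤ < a + b → 0ℤ < a ⊎ 0ℤ < b
0<+⇒0<⊎0< {a} {b} 0<a+b with 0ℤ <? a | 0ℤ <? b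
... | yes 0<a | _       = inj₁ 0<a
... | no _    | yes 0<b = inj₂ 0<b
... | no a≯0  | no b≯0  = ⊥-elim (<⇒≱ 0<a+b (+-mono-≤ (≮⇒≥ a≯0) (≮⇒≥ b≯0)))

+<0⇒<0⊎<0 : ∀ {a b} → a + b < 0ℤ → a < 0ℤ ⊎ b < 0ℤ
+<0⇒<0⊎<0 {a} {b} a+b<0 with a <? 0ℤ | b <? 0ℤ
... | yes a<0 | _       = inj₁ a<0
... | no _    | yes b<0 = inj₂ b<0
... | no a≮0  | no b≮0  = ⊥-elim (<⇒≱ a+b<0 (+-mono-≤ (≮⇒≥ a≮0) (≮⇒≥ b≮0)))

+-suc : ∀ a b → a + sucℤ b ≡ sucℤ (a + b)
+-suc a b = begin
  a + (1ℤ + b) ≡⟨ +-comm a (1ℤ + b) ⟩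
  1ℤ + b + a   ≡⟨ +-assoc 1ℤ b a ⟩
  1ℤ + (b + a) ≡⟨ cong sucℤ (+-comm b a) ⟩
  1ℤ + (a + b) ∎
  where open ≡-Reasoning

sumValues : ∀ {n m} → (Fin n → ℤ) → ℤ → ℤ → (Fin m → ℤ) → Fin n ⊎ Fin m → ℤ
sumValues v a b w = [ (λ i → v i + b) , (λ j → a + w j) ]′

sumValues-↑ˡ : ∀ {n m} v a b (w : Fin m → ℤ) i → sumValues v a b w (splitAt n (i ↑ˡ m)) ≡ v i + b
sumValues-↑ˡ {n} {m} v a b w i = cong (sumValues v a b w) (splitAt-↑ˡ n i m)

sumValues-↑ʳ : ∀ {n m} (v : Fin n → ℤ) a b w j → sumValues v a b w (splitAt n (n ↑ʳ j)) ≡ a + w j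
sumValues-↑ʳ {n} {m} v a b w j = cong (sumValues v a b w) (splitAt-↑ʳ n m j)

simplestBetween-+ : ∀ {nL nR mL mR a b} {vL : Fin nL → ℤ} {vR : Fin nR → ℤ}
                      {wL : Fin mL → ℤ} {wR : Fin mR → ℤ} →
                    SimplestBetween vL vR a → SimplestBetween wL wR b →
                    SimplestBetween (sumValues vL a b wL ∘ splitAt nL) (sumValues vR a b wR ∘ splitAt nR)
                                    (a + b)
simplestBetween-+ {nL} {nR} {mL} {mR} {a} {b} {vL} {vR} {wL} {wR} s t = record
  { left<     = λ k → [_,_] {C = λ k′ → sumValues vL a b wL k′ < a + b}
                  (λ i → +-monoˡ-< b (left< s i)) (λ j → +-monoʳ-< a (left< t j)) (splitAt nL k)
  ; <right    = λ k → [_,_] {C = λ k′ → a + b < sumValues vR a b wR k′}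
                  (λ i → +-monoˡ-< b (<right s i)) (λ j → +-monoʳ-< a (<right t j)) (splitAt nR k)
  ; pred∈left = [ pred∈leftˡ , pred∈leftʳ ]′ ∘ 0<+⇒0<⊎0<
  ; suc∈right = [ suc∈rightˡ , suc∈rightʳ ]′ ∘ +<0⇒<0⊎<0
  }
  where
  pred∈leftˡ : 0ℤ < a → ∃[ k ] sumValues vL a b wL (splitAt nL k) ≡ pred (a + b)
  pred∈leftˡ 0<a with pred∈left s 0<a
  ... | i , vLi≡ = i ↑ˡ mL , trans (sumValues-↑ˡ vL a b wL i) (trans (cong (_+ b) vLi≡) (pred-+ a b))

  pred∈leftʳ : 0ℤ < b → ∃[ k ] sumValues vL a b wL (splitAt nL k) ≡ pred (a + b)
  pred∈leftʳ 0<b with pred∈left t 0<b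
  ... | j , wLj≡ = nL ↑ʳ j , trans (sumValues-↑ʳ vL a b wL j) (trans (cong (_+_ a) wLj≡) (+-pred a b))

  suc∈rightˡ : a < 0ℤ → ∃[ k ] sumValues vR a b wR (splitAt nR k) ≡ sucℤ (a + b)
  suc∈rightˡ a<0 with suc∈right s a<0
  ... | i , vRi≡ = i ↑ˡ mR , trans (sumValues-↑ˡ vR a b wR i) (trans (cong (_+ b) vRi≡) (+-assoc 1ℤ a b))

  suc∈rightʳ : b < 0ℤ → ∃[ k ] sumValues vR a b wR (splitAt nR k) ≡ sucℤ (a + b)
  suc∈rightʳ b<0 with suc∈right t b<0
  ... | j , wRj≡ = nR ↑ʳ j , trans (sumValues-↑ʳ vR a b wR j) (trans (cong (_+_ a) wRj≡) (+-suc a b))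

⇓-+ : ∀ {G H a b} → G ⇓ a → H ⇓ b → G +G H ⇓ a + b
⇓-+ {G@(mk nL gL nR gR)} {a = a} (byOptions {vL = vL} {vR} gL⇓ gR⇓ s) = go
  where
  go : ∀ {H b} → H ⇓ b → G +G H ⇓ a + b
  go {H@(mk mL hL mR hR)} {b} H⇓@(byOptions {vL = wL} {wR} hL⇓ hR⇓ t) =
    byOptions
      (λ k → [_,_] {C = λ k′ → [ (λ i → gL i +G H) , (λ j → G +G hL j) ]′ k′ ⇓ sumValues vL a b wL k′}
               (λ i → ⇓-+ (gL⇓ i) H⇓) (λ j → go (hL⇓ j)) (splitAt nL k))
      (λ k → [_,_] {C = λ k′ → [ (λ i → gR i +G H) , (λ j → G +G hR j) ]′ k′ ⇓ sumValues vR a b wR k′}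
               (λ i → ⇓-+ (gR⇓ i) H⇓) (λ j → go (hR⇓ j)) (splitAt nR k))
      (simplestBetween-+ s t)

0G⇓0 : 0G ⇓ 0ℤ
0G⇓0 = byOptions {vL = λ ()} {vR = λ ()} (λ ()) (λ ()) record
  { left< = λ () ; <right = λ ()
  ; pred∈left = ⊥-elim ∘ <-irrefl refl ; suc∈right = ⊥-elim ∘ <-irrefl refl }

1G⇓1 : 1G ⇓ 1ℤ
1G⇓1 = byOptions {vR = λ ()} (λ _ → 0G⇓0) (λ ()) record
  { left< = λ _ → +<+ (s≤s z≤n) ; <right = λ ()
  ; pred∈left = λ _ → zero , refl ; suc∈right = λ { (+<+ ()) } }

ones⇓ : ∀ m → ones m ⇓ + m
ones⇓ zero    = 0G⇓0
ones⇓ (suc m) = subst (ones m +G 1G ⇓_) (cong +_ (ℕ.+-comm m 1)) (⇓-+ (ones⇓ m) 1G⇓1)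

intGame⇓ : ∀ z → intGame z ⇓ z
intGame⇓ (+ m)    = ones⇓ m
intGame⇓ -[1+ m ] = ⇓-neg (ones⇓ (suc m))

⇓⇒integerValued : ∀ {G z} → G ⇓ z → IntegerValued G
⇓⇒integerValued {G} {z} G⇓z =
  z , ≤G-trans G (canon z) I (proj₁ G≈) (proj₂ I≈) , ≤G-trans I (canon z) G (proj₁ I≈) (proj₂ G≈)
  where
  I = intGame z
  G≈ = ⇓-sound G⇓z
  I≈ = ⇓-sound (intGame⇓ z)

∈ρ-remove : ∀ {n} {ρ : Subset n → Subset n} → IsRemovability n ρ →
            ∀ {A x y} → x ∈ ρ A → x ≢ y → x ∈ ρ (A - y)
∈ρ-remove (ρ-restrict , ρ⊆) {A} {x} {y} x∈ρA x≢y =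
  ρ-restrict (A - y) A (p─q⊆p A _) (x∈p∩q⁺ (x∈ρA , x∈p∧x≢y⇒x∈p-y (ρ⊆ A x∈ρA) x≢y))

module ElementRemoval {n} (col : Fin n → Color) (ρ : Subset n → Subset n) (isρ : IsRemovability n ρ)
  where

  game : ℕ → Subset n → Game
  game = positionGame col ρ

  move : ∀ A c → Fin (length (movesOf col ρ A c)) → Fin n
  move A c = lookup (movesOf col ρ A c)

  movable? : ∀ A c x → Dec (x ∈ ρ A × col x ≡ c)
  movable? A c x = (x ∈? ρ A) ×-dec (col x ≟C c)

  move∈ρ : ∀ A c i → move A c i ∈ ρ A
  move∈ρ A c i = proj₁ (proj₂ (∈-filter⁻ (movable? A c) {xs = allFin n} (∈-lookup i)))

  move-col : ∀ A c i → col (move A c i) ≡ c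
  move-col A c i = proj₂ (proj₂ (∈-filter⁻ (movable? A c) {xs = allFin n} (∈-lookup i)))

  move∈ : ∀ A c i → move A c i ∈ A
  move∈ A c i = proj₂ isρ A (move∈ρ A c i)

  ∈moves : ∀ {A c x} → x ∈ ρ A → col x ≡ c → ∃[ i ] move A c i ≡ x
  ∈moves {A} {c} {x} x∈ρA colx≡c = index x∈ , sym (lookup-index x∈)
    where x∈ = ∈-filter⁺ (movable? A c) (∈-allFin x) (x∈ρA , colx≡c)

  white≢black : ∀ A i j → move A white i ≢ move A black j
  white≢black A i j x≡y with trans (sym (move-col A white i)) (trans (cong col x≡y) (move-col A black j))
  ... | ()

  black-after-white : ∀ A i j → ∃[ j′ ] move (A - move A white i) black j′ ≡ move A black j
  black-after-white A i j =
    ∈moves (∈ρ-remove isρ (move∈ρ A black j) (white≢black A i j ∘ sym)) (move-col A black j)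

  white-after-black : ∀ A i j → ∃[ i′ ] move (A - move A black j) white i′ ≡ move A white i
  white-after-black A i j =
    ∈moves (∈ρ-remove isρ (move∈ρ A white i) (white≢black A i j)) (move-col A white i)

  fuel-after-move : ∀ {k} A c i → ∣ A ∣ ℕ.≤ suc k → ∣ A - move A c i ∣ ℕ.≤ k
  fuel-after-move A c i |A|≤ = ℕ.≤-pred (ℕ.≤-trans (x∈p⇒∣p-x∣<∣p∣ (move∈ A c i)) |A|≤)

  gap : ∀ k A i j {a b} → ∣ A - move A white i ∣ ℕ.≤ k →
        game k (A - move A white i) ⇓ a → game k (A - move A black j) ⇓ b → sucℤ a < b
  gap zero A i j |A-x|≤0 _ _ = ⊥-elim (ℕ.n≮0 (ℕ.<-≤-trans (x∈p⇒∣p-x∣<∣p∣ y∈A-x) |A-x|≤0))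
    where y∈A-x = x∈p∧x≢y⇒x∈p-y (move∈ A black j) (white≢black A i j ∘ sym)
  gap (suc k) A i j {b = b} _ (byOptions {vR = vR} _ gR⇓ s) (byOptions {vL = vL} gL⇓ _ t)
    with black-after-white A i j | white-after-black A i j
  ... | j′ , y′≡y | i′ , x′≡x =
    ≤-<-trans (i<j⇒suc[i]≤j (<right s j′)) (subst (_< b) (sym same-value) (left< t i′))
    where
    x = move A white i
    y = move A black j
    same-position : A - x - move (A - x) black j′ ≡ A - y - move (A - y) white i′
    same-position = begin
      A - x - move (A - x) black j′ ≡⟨ cong (_-_ (A - x)) y′≡y ⟩
      A - x - y                     ≡⟨ p─x─y≡p─y─x A x y ⟩
      A - y - x                     ≡⟨ cong (_-_ (A - y)) (sym x′≡x) ⟩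
      A - y - move (A - y) white i′ ∎
      where open ≡-Reasoning
    same-value : vR j′ ≡ vL i′
    same-value = ⇓-unique (subst (_⇓ vR j′) (cong (game k) same-position) (gR⇓ j′)) (gL⇓ i′)

  position⇓ : ∀ k A → ∣ A ∣ ℕ.≤ k → ∃ (game k A ⇓_)
  position⇓ zero    A _    = 0ℤ , 0G⇓0
  position⇓ (suc k) A |A|≤ =
    _ , byOptions (proj₂ ∘ white⇓) (proj₂ ∘ black⇓)
          (proj₂ (simplest (proj₁ ∘ white⇓) (proj₁ ∘ black⇓) separated))
    where
    white⇓ : ∀ i → ∃ (game k (A - move A white i) ⇓_)
    white⇓ i = position⇓ k _ (fuel-after-move A white i |A|≤)
    black⇓ : ∀ j → ∃ (game k (A - move A black j) ⇓_)
    black⇓ j = position⇓ k _ (fuel-after-move A black j |A|≤)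
    separated : ∀ i j → sucℤ (proj₁ (white⇓ i)) < proj₁ (black⇓ j)
    separated i j = gap k A i j (fuel-after-move A white i |A|≤) (proj₂ (white⇓ i)) (proj₂ (black⇓ j))

  integerValued : IntegerValued (elementRemovalGame n col ρ)
  integerValued = ⇓⇒integerValued (proj₂ (position⇓ n ⊤ (∣p∣≤n ⊤)))

does∧¬does⇔ : ∀ {p q} {P : Set p} {Q : Set q} (P? : Dec P) (Q? : Dec Q) →
              does P? ∧ not (does Q?) ≡ true ⇔ (P × ¬ Q)
does∧¬does⇔ P? Q? = mk⇔ (to P? Q?) (from P? Q?)
  where
  to : ∀ P? Q? → does P? ∧ not (does Q?) ≡ true → _
  to (yes p) (no ¬q) _ = p , ¬q
  from : ∀ P? Q? → _ → does P? ∧ not (does Q?) ≡ true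
  from (yes _) (no _)  _        = refl
  from (yes _) (yes q) (_ , ¬q) = ⊥-elim (¬q q)
  from (no ¬p) _       (p , _)  = ⊥-elim (¬p p)

∈tabulate⇔ : ∀ {n} (f : Fin n → Bool) x → x ∈ tabulate f ⇔ f x ≡ true
∈tabulate⇔ f x = mk⇔ (λ x∈ → trans (sym (lookup∘tabulate f x)) ([]=⇒lookup x∈))
                     (λ fx≡ → lookup⇒[]= x (tabulate f) (trans (lookup∘tabulate f x) fx≡))

module _ {n} (_≤P_ : Fin n → Fin n → Set) (_≤P?_ : ∀ x y → Dec (x ≤P y)) where

  StrictlyBelowSome : Subset n → Fin n → Set
  StrictlyBelowSome A x = ∃[ y ] y ∈ A × x ≤P y × x ≢ y

  ∈maximalIn⇔ : ∀ A x → x ∈ maximalIn _≤P_ _≤P?_ A ⇔ (x ∈ A × ¬ StrictlyBelowSome A x)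
  ∈maximalIn⇔ A x = mk⇔
    (Equivalence.to (does∧¬does⇔ (x ∈? A) below?) ∘ Equivalence.to (∈tabulate⇔ _ x))
    (Equivalence.from (∈tabulate⇔ _ x) ∘ Equivalence.from (does∧¬does⇔ (x ∈? A) below?))
    where below? = any? (λ y → (y ∈? A) ×-dec ((x ≤P? y) ×-dec ¬? (x ≟ y)))

  maximalIn-isRemovability : IsRemovability n (maximalIn _≤P_ _≤P?_)
  maximalIn-isRemovability = restrict , λ A → proj₁ ∘ to (∈maximalIn⇔ A _)
    where
    open Equivalence
    restrict : ∀ A B → A ⊆ B → maximalIn _≤P_ _≤P?_ B ∩ A ⊆ maximalIn _≤P_ _≤P?_ A
    restrict A B A⊆B {x} x∈ =
      let (x∈ρB , x∈A) = x∈p∩q⁻ _ A x∈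
          (_ , x-maxB) = to (∈maximalIn⇔ B x) x∈ρB
      in from (∈maximalIn⇔ A x) (x∈A , λ (y , y∈A , x≤y , x≢y) → x-maxB (y , A⊆B y∈A , x≤y , x≢y))

mainTheorem1 : ((n : ℕ) (col : Fin n → Color) (ρ : Subset n → Subset n) →
                 IsRemovability n ρ → IntegerValued (elementRemovalGame n col ρ))
               × ((n : ℕ) (_≤P_ : Fin n → Fin n → Set) (po : IsDecPartialOrder _≡_ _≤P_)
                 (col : Fin n → Color) → IntegerValued (pomaxGame n _≤P_ po col))
mainTheorem1 =
  (λ n col ρ isρ → ElementRemoval.integerValued col ρ isρ) ,
  (λ n _≤P_ po col → ElementRemoval.integerValued col _
                       (maximalIn-isRemovability _≤P_ (IsDecPartialOrder._≤?_ po)))
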